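{- Let $m\ge 2$. Among the long brush graphs $LP_{n,m}$ with $n\ge 3$ that are $n$-distance magic, the one of least order is $LP_{\frac{m(m-1)}{2},\,m}$, i.e. the one with $n=\frac{m(m-1)}{2}$.
   Context: All graphs are finite, simple and undirected; $d(u,v)$ is graph distance. For $u\in V(G)$ and $k\in\mathbb{N}$, $\partial N_k(u)=\{v\in V(G): d(u,v)=k\}$. For a graph $G$ of order $p\ge3$, a $k$-distance magic labeling is a bijection $f:V(G)\to\{1,\dots,p\}$ together with a constant $M$ such that $\sum_{w\in\partial N_k(u)} f(w)=M$ for every vertex $u$ with $\partial N_k(u)\neq\emptyset$, and $G$ has at least one pair of vertices at distance $k$; $G$ is $k$-distance magic if it has such a labeling. A long brush $LP_{n,m}$ ($m,n\in\mathbb{N}$, $m+n\ge3$) has vertex set $\{u_1,\dots,u_n,v_1,\dots,v_m\}$ (order $m+n$), with edges $u_iu_{i+1}$ ($1\le i<n$), $u_1v_i$ ($1\le i\le m$), and an arbitrary set of edges among $v_1,\dots,v_m$. -}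

module Defs where

open import Data.Nat using (ℕ; zero; suc; _+_; _*_; _∸_; _≡ᵇ_; _≤_)
open import Data.Nat.DivMod using (_/_)
open import Data.Bool using (Bool; true; false; _∨_; _∧_; not; T; if_then_else_)
open import Data.Fin using (Fin; toℕ; splitAt)

open import Data.List using (List; map; allFin)
open import Data.Bool.ListAction using (any)
open import Data.Nat.ListAction using (sum)
open import Data.Sum using (_⊎_; inj₁; inj₂)
open import Data.Product using (Σ; ∃; ∃-syntax; _×_)
open import Function.Definitions using (Bijective)
open import Relation.Binary.PropositionalEquality using (_≡_)

Adj : ℕ → Set
Adj p = Fin p → Fin p → Bool

anyFin : ∀ {p} → (Fin p → Bool) → Bool
anyFin {p} g = any g (allFin p)

sumFin : ∀ {p} → (Fin p → ℕ) → ℕ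
sumFin {p} g = sum (map g (allFin p))

-- within A k u w = true  iff  there is a walk of length ≤ k from u to w,
-- i.e. d(u,w) ≤ k.
within : ∀ {p} → Adj p → ℕ → Fin p → Fin p → Bool
within A zero    u w = toℕ u ≡ᵇ toℕ w
within A (suc k) u w = within A k u w ∨ anyFin (λ x → within A k u x ∧ A x w)

atDist : ∀ {p} → Adj p → ℕ → Fin p → Fin p → Bool
atDist A zero    u w = within A zero u w
atDist A (suc k) u w = within A (suc k) u w ∧ not (within A k u w)

-- The label of vertex x under a bijection f : Fin p → Fin p is 1 + toℕ (f x),
-- so labels range bijectively over {1,…,p}.
label : ∀ {p} → (Fin p → Fin p) → Fin p → ℕ
label f x = suc (toℕ (f x))

sphereSum : ∀ {p} → Adj p → ℕ → (Fin p → Fin p) → Fin p → ℕ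
sphereSum A k f u = sumFin (λ w → if atDist A k u w then label f w else 0)

-- k-distance magic labeling and k-distance magic graph (order p ≥ 3 is
-- part of the context; it is guaranteed for the long brushes considered).
IsKDistMagicLabeling : ∀ {p} → Adj p → ℕ → (Fin p → Fin p) → ℕ → Set
IsKDistMagicLabeling {p} A k f M =
  Bijective _≡_ _≡_ f ×
  (∃[ u ] ∃[ v ] T (atDist A k u v)) ×
  (∀ u → (∃[ w ] T (atDist A k u w)) → sphereSum A k f u ≡ M)

IsKDistMagic : ∀ {p} → Adj p → ℕ → Set
IsKDistMagic {p} A k = ∃[ f ] ∃[ M ] IsKDistMagicLabeling A k f M

record BristleEdges (m : ℕ) : Set where
  field
    vadj   : Fin m → Fin m → Bool
    vsym   : ∀ a b → vadj a b ≡ vadj b a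
    virref : ∀ a → vadj a a ≡ false
open BristleEdges public

-- Long brush LP_{n,m} on Fin (n + m):
--   index i < n  (inj₁ i)  is u_{i+1},   index n + j (inj₂ j) is v_{j+1}.
-- Edges: u_i u_{i+1}, u_1 v_j, and the bristle edges among the v's.
brushAdjAux : (n m : ℕ) → BristleEdges m → Fin n ⊎ Fin m → Fin n ⊎ Fin m → Bool
brushAdjAux n m E (inj₁ i) (inj₁ j) = (suc (toℕ i) ≡ᵇ toℕ j) ∨ (suc (toℕ j) ≡ᵇ toℕ i)
brushAdjAux n m E (inj₁ i) (inj₂ b) = toℕ i ≡ᵇ 0
brushAdjAux n m E (inj₂ a) (inj₁ j) = toℕ j ≡ᵇ 0
brushAdjAux n m E (inj₂ a) (inj₂ b) = vadj E a b

LP : (n m : ℕ) → BristleEdges m → Adj (n + m)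
LP n m E x y = brushAdjAux n m E (splitAt n x) (splitAt n y)

tri : ℕ → ℕ
tri m = (m * (m ∸ 1)) / 2

-- A magic labeling of LP_{n,m} with n ≥ 3 has to be constant on the n-spheres of the last path
-- vertex u_n and of a bristle v. The first sphere is the set of all bristles; the second is {u_n},
-- because bristles are pairwise at distance at most 2 < n. So the m bristle labels, being distinct
-- positive integers, sum to at least 1 + ⋯ + m and at most the label of u_n ≤ n + m, which gives
-- n ≥ m(m-1)/2. For n = m(m-1)/2, which is never 2, and no bristle edges, the labeling that gives
-- the bristles 1, …, m and the path m+1, …, n+m attains equality, and every other vertex has an
-- empty n-sphere.
module Submission where

open import Defs
open import Data.Nat using (ℕ; zero; suc; _+_; _*_; _∸_; _≤_; _<_; _≡ᵇ_; ∣_-_∣; z≤n; s≤s; _≤?_)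
open import Data.Nat.Properties
open import Data.Nat.DivMod using (_/_; m*n/n≡m)
open import Data.Nat.ListAction using (sum)
open import Data.Nat.Tactic.RingSolver using (solve-∀)
open import Data.Bool using (Bool; true; false; not; T; _∧_; if_then_else_)
open import Data.Bool.Properties using (T-∨; T-∧)
open import Data.Fin as F using (Fin; toℕ; fromℕ; fromℕ<; inject₁; punchIn; splitAt; join; _↑ˡ_; _↑ʳ_)
open import Data.Fin.Properties
  using (toℕ-injective; toℕ-fromℕ; toℕ-fromℕ<; toℕ-inject₁; toℕ<n; toℕ-cast; toℕ-↑ˡ; toℕ-↑ʳ;
         splitAt-↑ˡ; splitAt-↑ʳ; splitAt-join; join-splitAt; ↑ʳ-injective; cast-involutive; +↔⊎;
         punchIn-injective; punchInᵢ≢i; injective⇒≤; any?)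
open import Data.List using (allFin; tabulate)
open import Data.List.Properties using (map-tabulate)
open import Data.List.Relation.Unary.Any using (satisfied)
open import Data.List.Relation.Unary.Any.Properties using (any⁺; any⁻)
open import Data.List.Membership.Propositional using (lose)
open import Data.List.Membership.Propositional.Properties using (∈-allFin)
open import Data.Product using (Σ; ∃-syntax; _×_; _,_)
open import Data.Sum using (_⊎_; inj₁; inj₂; swap)
import Data.Sum as Sum
open import Data.Sum.Properties using (swap-↔)
open import Function using (_∘_; id; _⇔_; _↔_; mk⇔; mk↔ₛ′; Equivalence; Inverse; Bijection)
open import Function.Definitions using (Injective; Bijective)
open import Function.Construct.Composition using (_↔-∘_)
open import Function.Construct.Symmetry using (↔-sym)
open import Function.Properties.Inverse using (↔⇒⤖)
open import Relation.Nullary using (¬_; Dec; yes; no; contradiction)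
open import Relation.Binary.Definitions using (tri<; tri≈; tri>)
open import Relation.Binary.PropositionalEquality
open import Algebra.Properties.CommutativeMonoid.Sum +-0-commutativeMonoid
  using (sum-cong-≗; sum-remove; sum-replicate-zero) renaming (sum to ∑)

∣m-1+n∣≡1+∣m-n∣ : ∀ {m n} → m ≤ n → ∣ m - suc n ∣ ≡ suc ∣ m - n ∣
∣m-1+n∣≡1+∣m-n∣ z≤n       = refl
∣m-1+n∣≡1+∣m-n∣ (s≤s m≤n) = ∣m-1+n∣≡1+∣m-n∣ m≤n

∣m-n∣≡1+∣m-1+n∣ : ∀ {m n} → n < m → ∣ m - n ∣ ≡ suc ∣ m - suc n ∣
∣m-n∣≡1+∣m-1+n∣ {suc m} {zero}  _         = cong suc (sym (∣-∣-identityʳ m))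
∣m-n∣≡1+∣m-1+n∣ {suc m} {suc n} (s≤s n<m) = ∣m-n∣≡1+∣m-1+n∣ n<m

∣n-1+n∣≡1 : ∀ n → ∣ n - suc n ∣ ≡ 1
∣n-1+n∣≡1 n = trans (∣m-1+n∣≡1+∣m-n∣ {n} ≤-refl) (cong suc (∣n-n∣≡0 n))

∣toℕ-toℕ∣<n : ∀ {n} (i j : Fin n) → ∣ toℕ i - toℕ j ∣ < n
∣toℕ-toℕ∣<n {suc n} i j =
  s≤s (≤-trans (∣m-n∣≤m⊔n (toℕ i) (toℕ j)) (⊔-lub (≤-pred (toℕ<n i)) (≤-pred (toℕ<n j))))

sum-tabulate : ∀ {p} (g : Fin p → ℕ) → sum (tabulate g) ≡ ∑ g
sum-tabulate {zero}  g = refl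
sum-tabulate {suc p} g = cong (g F.zero +_) (sum-tabulate (g ∘ F.suc))

sumFin≡∑ : ∀ {p} (g : Fin p → ℕ) → sumFin g ≡ ∑ g
sumFin≡∑ g = trans (cong sum (map-tabulate id g)) (sum-tabulate g)

∑-↑ˡ+↑ʳ : ∀ n {m} (g : Fin (n + m) → ℕ) → ∑ g ≡ ∑ (g ∘ (_↑ˡ m)) + ∑ (g ∘ (n ↑ʳ_))
∑-↑ˡ+↑ʳ zero    g = refl
∑-↑ˡ+↑ʳ (suc n) g =
  trans (cong (g F.zero +_) (∑-↑ˡ+↑ʳ n (g ∘ F.suc))) (sym (+-assoc (g F.zero) _ _))

∑-zero : ∀ {p} {g : Fin p → ℕ} → (∀ i → g i ≡ 0) → ∑ g ≡ 0
∑-zero {p} g≡0 = trans (sum-cong-≗ g≡0) (sum-replicate-zero p)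

∑-single : ∀ {p} (g : Fin (suc p) → ℕ) j → (∀ i → i ≢ j → g i ≡ 0) → ∑ g ≡ g j
∑-single g j g≡0 = begin
  ∑ g                          ≡⟨ sum-remove g ⟩
  g j + ∑ (g ∘ punchIn j)      ≡⟨ cong (g j +_) (∑-zero (λ i → g≡0 _ (punchInᵢ≢i j i))) ⟩
  g j + 0                      ≡⟨ +-identityʳ (g j) ⟩
  g j                          ∎
  where open ≡-Reasoning

∑-suc : ∀ {p} (g : Fin p → ℕ) → ∑ (suc ∘ g) ≡ p + ∑ g
∑-suc {zero}  g = refl
∑-suc {suc p} g = cong suc (begin
  g F.zero + ∑ (suc ∘ g ∘ F.suc) ≡⟨ cong (g F.zero +_) (∑-suc (g ∘ F.suc)) ⟩
  g F.zero + (p + ∑ (g ∘ F.suc)) ≡⟨ +-comm (g F.zero) _ ⟩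
  (p + ∑ (g ∘ F.suc)) + g F.zero ≡⟨ +-assoc p _ _ ⟩
  p + (∑ (g ∘ F.suc) + g F.zero) ≡⟨ cong (p +_) (+-comm _ (g F.zero)) ⟩
  p + ∑ g                        ∎)
  where open ≡-Reasoning

2*∑toℕ : ∀ m → 2 * ∑ (toℕ {m}) ≡ m * (m ∸ 1)
2*∑toℕ zero          = refl
2*∑toℕ (suc zero)    = refl
2*∑toℕ (suc (suc k)) = begin
  2 * ∑ (toℕ {2 + k})             ≡⟨ cong (2 *_) (∑-suc {suc k} toℕ) ⟩
  2 * (suc k + ∑ (toℕ {suc k}))   ≡⟨ *-distribˡ-+ 2 (suc k) _ ⟩
  2 * suc k + 2 * ∑ (toℕ {suc k}) ≡⟨ cong (2 * suc k +_) (2*∑toℕ (suc k)) ⟩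
  2 * suc k + suc k * k           ≡⟨ ring k ⟩
  suc (suc k) * suc k             ∎
  where
    open ≡-Reasoning
    ring : ∀ k → 2 * suc k + suc k * k ≡ suc (suc k) * suc k
    ring = solve-∀

tri≡∑toℕ : ∀ m → tri m ≡ ∑ (toℕ {m})
tri≡∑toℕ m = begin
  m * (m ∸ 1) / 2         ≡⟨ cong (_/ 2) (2*∑toℕ m) ⟨
  2 * ∑ (toℕ {m}) / 2     ≡⟨ cong (_/ 2) (*-comm 2 (∑ (toℕ {m}))) ⟩
  ∑ (toℕ {m}) * 2 / 2     ≡⟨ m*n/n≡m (∑ (toℕ {m})) 2 ⟩
  ∑ (toℕ {m})             ∎
  where open ≡-Reasoning

∑toℕ≤∑-injective : ∀ {p} (g : Fin p → ℕ) → Injective _≡_ _≡_ g → ∑ (toℕ {p}) ≤ ∑ g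
∑toℕ≤∑-injective {zero}  g g-inj = z≤n
∑toℕ≤∑-injective {suc p} g g-inj with any? (λ i → p ≤? g i)
... | yes (j , p≤gj) = begin
  ∑ (toℕ {suc p})          ≡⟨ ∑-suc {p} toℕ ⟩
  p + ∑ (toℕ {p})          ≤⟨ +-mono-≤ p≤gj (∑toℕ≤∑-injective (g ∘ punchIn j) (punchIn-injective j _ _ ∘ g-inj)) ⟩
  g j + ∑ (g ∘ punchIn j)  ≡⟨ sum-remove g ⟨
  ∑ g                      ∎
  where open ≤-Reasoning
... | no ∄j = contradiction (injective⇒≤ squeeze-inj) (<-irrefl refl)
  where
    g<p : ∀ i → g i < p
    g<p i = ≰⇒> (∄j ∘ (i ,_))
    squeeze : Fin (suc p) → Fin p
    squeeze i = fromℕ< (g<p i)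
    squeeze-inj : Injective _≡_ _≡_ squeeze
    squeeze-inj {i} {j} e = g-inj (begin
      g i                  ≡⟨ toℕ-fromℕ< (g<p i) ⟨
      toℕ (squeeze i)      ≡⟨ cong toℕ e ⟩
      toℕ (squeeze j)      ≡⟨ toℕ-fromℕ< (g<p j) ⟩
      g j                  ∎)
      where open ≡-Reasoning

∑toℕ≢2 : ∀ m → ∑ (toℕ {m}) ≢ 2
∑toℕ≢2 0                   ()
∑toℕ≢2 1                   ()
∑toℕ≢2 2                   ()
∑toℕ≢2 (suc (suc (suc k))) ()

if-T : ∀ {A : Set} {b} {x y : A} → T b → (if b then x else y) ≡ x
if-T {b = true} _ = refl

if-¬T : ∀ {A : Set} {b} {x y : A} → ¬ T b → (if b then x else y) ≡ y
if-¬T {b = true}  ¬t = contradiction _ ¬t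
if-¬T {b = false} _  = refl

T-not : ∀ {b} → T (not b) ⇔ (¬ T b)
T-not {true}  = mk⇔ (λ ()) (λ ¬t → ¬t _)
T-not {false} = mk⇔ (λ _ ()) (λ _ → _)

T-anyFin : ∀ {p} (g : Fin p → Bool) → T (anyFin g) ⇔ (∃[ x ] T (g x))
T-anyFin {p} g = mk⇔ (satisfied ∘ any⁻ g (allFin p)) (λ (x , t) → any⁺ g (lose (∈-allFin x) t))

T-within-zero : ∀ {p} {A : Adj p} {x y} → T (within A 0 x y) ⇔ (x ≡ y)
T-within-zero {x = x} {y} =
  mk⇔ (toℕ-injective ∘ ≡ᵇ⇒≡ (toℕ x) (toℕ y)) (≡⇒≡ᵇ (toℕ x) (toℕ y) ∘ cong toℕ)

record IsGraphDistance {p} (A : Adj p) (D : Fin p → Fin p → ℕ) : Set where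
  field
    D-refl : ∀ x → D x x ≡ 0
    D≡0⇒≡  : ∀ {x y} → D x y ≡ 0 → x ≡ y
    D-step : ∀ x {y z} → T (A z y) → D x y ≤ suc (D x z)
    D-pred : ∀ x y → 0 < D x y → ∃[ z ] T (A z y) × suc (D x z) ≤ D x y

module _ {p} {A : Adj p} {D : Fin p → Fin p → ℕ} (isDist : IsGraphDistance A D) where
  open IsGraphDistance isDist

  within⇒D≤ : ∀ k {x y} → T (within A k x y) → D x y ≤ k
  within⇒D≤ zero {x} t = ≤-reflexive (trans (cong (D x) (sym x≡y)) (D-refl x))
    where x≡y = Equivalence.to (T-within-zero {A = A}) t
  within⇒D≤ (suc k) {x} {y} t with Equivalence.to (T-∨ {within A k x y}) t
  ... | inj₁ t′ = m≤n⇒m≤1+n (within⇒D≤ k t′)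
  ... | inj₂ t′ with Equivalence.to (T-anyFin (λ z → within A k x z ∧ A z y)) t′
  ... | z , tz with Equivalence.to (T-∧ {within A k x z}) tz
  ... | xz , zy = ≤-trans (D-step x zy) (s≤s (within⇒D≤ k xz))

  D≤⇒within : ∀ k {x y} → D x y ≤ k → T (within A k x y)
  D≤⇒within zero    D≤0 = Equivalence.from (T-within-zero {A = A}) (D≡0⇒≡ (n≤0⇒n≡0 D≤0))
  D≤⇒within (suc k) {x} {y} D≤1+k with D x y ≤? k
  ... | yes D≤k = Equivalence.from (T-∨ {within A k x y}) (inj₁ (D≤⇒within k D≤k))
  ... | no  D≰k with D-pred x y (≤-trans (s≤s z≤n) (≰⇒> D≰k))
  ... | z , zy , D<D = Equivalence.from (T-∨ {within A k x y})
          (inj₂ (Equivalence.from (T-anyFin (λ z → within A k x z ∧ A z y))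
            (z , Equivalence.from T-∧ (D≤⇒within k (≤-pred (≤-trans D<D D≤1+k)) , zy))))

  T-atDist : ∀ k {x y} → T (atDist A k x y) ⇔ (D x y ≡ k)
  T-atDist zero = mk⇔ (n≤0⇒n≡0 ∘ within⇒D≤ 0) (D≤⇒within 0 ∘ ≤-reflexive)
  T-atDist (suc k) {x} {y} = mk⇔ to from
    where
      to : T (atDist A (suc k) x y) → D x y ≡ suc k
      to t with Equivalence.to (T-∧ {within A (suc k) x y}) t
      ... | near , ¬nearer = ≤-antisym (within⇒D≤ (suc k) near)
              (≰⇒> (Equivalence.to T-not ¬nearer ∘ D≤⇒within k))
      from : D x y ≡ suc k → T (atDist A (suc k) x y)
      from D≡ = Equivalence.from (T-∧ {within A (suc k) x y}) (D≤⇒within (suc k) (≤-reflexive D≡) ,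
        Equivalence.from T-not (λ t → 1+n≰n (subst (_≤ k) D≡ (within⇒D≤ k t))))

module LongBrush (n′ m : ℕ) (E : BristleEdges m) where

  n : ℕ
  n = suc n′

  Vertex : Set
  Vertex = Fin n ⊎ Fin m

  adjacent : Vertex → Vertex → Bool
  adjacent = brushAdjAux n m E

  bristleDist : Fin m → Fin m → ℕ
  bristleDist a b with a F.≟ b | vadj E a b
  ... | yes _ | _     = 0
  ... | no _  | true  = 1
  ... | no _  | false = 2

  bristleDist-refl : ∀ a → bristleDist a a ≡ 0
  bristleDist-refl a with a F.≟ a | vadj E a a
  ... | yes _   | _ = refl
  ... | no  a≢a | _ = contradiction refl a≢a

  bristleDist≡0⇒≡ : ∀ {a b} → bristleDist a b ≡ 0 → a ≡ b
  bristleDist≡0⇒≡ {a} {b} with a F.≟ b | vadj E a b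
  ... | yes a≡b | _     = λ _ → a≡b
  ... | no  _   | true  = λ ()
  ... | no  _   | false = λ ()

  bristleDist≤2 : ∀ a b → bristleDist a b ≤ 2
  bristleDist≤2 a b with a F.≟ b | vadj E a b
  ... | yes _ | _     = z≤n
  ... | no  _ | true  = s≤s z≤n
  ... | no  _ | false = ≤-refl

  bristleDist-adjacent : ∀ {a b} → T (vadj E a b) → bristleDist a b ≤ 1
  bristleDist-adjacent {a} {b} with a F.≟ b | vadj E a b
  ... | yes _ | _     = λ _ → z≤n
  ... | no  _ | true  = λ _ → ≤-refl
  ... | no  _ | false = λ ()

  bristleDist-≢ : ∀ {a b} → a ≢ b → 1 ≤ bristleDist a b
  bristleDist-≢ {a} {b} a≢b with a F.≟ b | vadj E a b
  ... | yes a≡b | _     = contradiction a≡b a≢b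
  ... | no  _   | true  = ≤-refl
  ... | no  _   | false = s≤s z≤n

  bristleDist-pos : ∀ a b → 0 < bristleDist a b →
    (T (vadj E a b) × bristleDist a b ≡ 1) ⊎ bristleDist a b ≡ 2
  bristleDist-pos a b with a F.≟ b | vadj E a b
  ... | yes _ | _     = λ ()
  ... | no  _ | true  = λ _ → inj₁ (_ , refl)
  ... | no  _ | false = λ _ → inj₂ refl

  bristleDist-step : ∀ a {b c} → T (vadj E c b) → bristleDist a b ≤ suc (bristleDist a c)
  bristleDist-step a {b} {c} cb = step (a F.≟ c)
    where
      step : Dec (a ≡ c) → bristleDist a b ≤ suc (bristleDist a c)
      step (yes a≡c) =
        ≤-trans (bristleDist-adjacent (subst (λ v → T (vadj E v b)) (sym a≡c) cb)) (s≤s z≤n)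
      step (no  a≢c) = ≤-trans (bristleDist≤2 a b) (s≤s (bristleDist-≢ a≢c))

  height : Vertex → ℕ
  height (inj₁ i) = suc (toℕ i)
  height (inj₂ _) = 0

  dist : Vertex → Vertex → ℕ
  dist (inj₂ a) (inj₂ b) = bristleDist a b
  dist x        y        = ∣ height x - height y ∣

  dist-refl : ∀ x → dist x x ≡ 0
  dist-refl (inj₁ i) = ∣n-n∣≡0 (suc (toℕ i))
  dist-refl (inj₂ a) = bristleDist-refl a

  dist≡0⇒≡ : ∀ {x y} → dist x y ≡ 0 → x ≡ y
  dist≡0⇒≡ {inj₁ i} {inj₁ j} d≡0 = cong inj₁ (toℕ-injective (suc-injective (∣m-n∣≡0⇒m≡n d≡0)))
  dist≡0⇒≡ {inj₂ a} {inj₂ b} d≡0 = cong inj₂ (bristleDist≡0⇒≡ d≡0)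

  height≤dist : ∀ x y → ∣ height x - height y ∣ ≤ dist x y
  height≤dist (inj₁ i) y        = ≤-refl
  height≤dist (inj₂ a) (inj₁ j) = ≤-refl
  height≤dist (inj₂ a) (inj₂ b) = z≤n

  path-adjacent : ∀ l j → suc (toℕ l) ≡ toℕ j ⊎ suc (toℕ j) ≡ toℕ l →
                  T (adjacent (inj₁ l) (inj₁ j))
  path-adjacent l j = Equivalence.from (T-∨ {suc (toℕ l) ≡ᵇ toℕ j}) ∘ Sum.map (≡⇒≡ᵇ _ _) (≡⇒≡ᵇ _ _)

  height-adjacent : ∀ z y → T (adjacent z y) → ∣ height z - height y ∣ ≤ 1
  height-adjacent (inj₁ l) (inj₁ j) zy with Equivalence.to (T-∨ {suc (toℕ l) ≡ᵇ toℕ j}) zy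
  ... | inj₁ l+1≡j = ≤-reflexive (begin
        ∣ toℕ l - toℕ j ∣       ≡⟨ cong (∣ toℕ l -_∣) (≡ᵇ⇒≡ _ _ l+1≡j) ⟨
        ∣ toℕ l - suc (toℕ l) ∣ ≡⟨ ∣n-1+n∣≡1 (toℕ l) ⟩
        1                       ∎)
        where open ≡-Reasoning
  ... | inj₂ j+1≡l = ≤-reflexive (begin
        ∣ toℕ l - toℕ j ∣       ≡⟨ ∣-∣-comm (toℕ l) (toℕ j) ⟩
        ∣ toℕ j - toℕ l ∣       ≡⟨ cong (∣ toℕ j -_∣) (≡ᵇ⇒≡ _ _ j+1≡l) ⟨
        ∣ toℕ j - suc (toℕ j) ∣ ≡⟨ ∣n-1+n∣≡1 (toℕ j) ⟩
        1                       ∎)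
        where open ≡-Reasoning
  height-adjacent (inj₁ l) (inj₂ b) zy = s≤s (≤-reflexive (≡ᵇ⇒≡ (toℕ l) 0 zy))
  height-adjacent (inj₂ a) (inj₁ j) zy = s≤s (≤-reflexive (≡ᵇ⇒≡ (toℕ j) 0 zy))
  height-adjacent (inj₂ a) (inj₂ b) zy = z≤n

  height-step : ∀ x y z → T (adjacent z y) → ∣ height x - height y ∣ ≤ suc (dist x z)
  height-step x y z zy = begin
    ∣ height x - height y ∣                         ≤⟨ ∣-∣-triangle (height x) (height z) (height y) ⟩
    ∣ height x - height z ∣ + ∣ height z - height y ∣ ≤⟨ +-mono-≤ (height≤dist x z) (height-adjacent z y zy) ⟩
    dist x z + 1                                    ≡⟨ +-comm (dist x z) 1 ⟩
    suc (dist x z)                                  ∎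
    where open ≤-Reasoning

  dist-step : ∀ x {y z} → T (adjacent z y) → dist x y ≤ suc (dist x z)
  dist-step (inj₂ a) {inj₂ b} {inj₁ l} _  = ≤-trans (bristleDist≤2 a b) (s≤s (s≤s z≤n))
  dist-step (inj₂ a) {inj₂ b} {inj₂ c} cb = bristleDist-step a cb
  dist-step (inj₁ i) {y}      {z}      zy = height-step (inj₁ i) y z zy
  dist-step (inj₂ a) {inj₁ j} {z}      zy = height-step (inj₂ a) (inj₁ j) z zy

  dist-pred : ∀ x y → 0 < dist x y → ∃[ z ] T (adjacent z y) × suc (dist x z) ≤ dist x y
  dist-pred (inj₂ a) (inj₂ b) d>0 with bristleDist-pos a b d>0
  ... | inj₁ (ab , d≡1) = inj₂ a , ab , ≤-reflexive (trans (cong suc (bristleDist-refl a)) (sym d≡1))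
  ... | inj₂ d≡2        = inj₁ F.zero , _ , ≤-reflexive (sym d≡2)
  dist-pred (inj₂ a) (inj₁ F.zero)    _ = inj₂ a , _ , s≤s (≤-reflexive (bristleDist-refl a))
  dist-pred (inj₂ a) (inj₁ (F.suc j)) _ =
    inj₁ (inject₁ j) , path-adjacent _ _ (inj₁ (cong suc (toℕ-inject₁ j))) ,
    ≤-reflexive (cong (suc ∘ suc) (toℕ-inject₁ j))
  dist-pred (inj₁ i) (inj₂ b) _ = inj₁ F.zero , _ , s≤s (≤-reflexive (∣-∣-identityʳ (toℕ i)))
  dist-pred (inj₁ i) (inj₁ j) d>0 with <-cmp (toℕ i) (toℕ j)
  ... | tri≈ _ i≡j _ = contradiction (trans (cong (∣_-_∣ (toℕ i)) (sym i≡j)) (∣n-n∣≡0 (toℕ i))) (>⇒≢ d>0)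
  dist-pred (inj₁ i) (inj₁ (F.suc j)) _ | tri< (s≤s i≤j) _ _ =
    inj₁ (inject₁ j) , path-adjacent _ _ (inj₁ (cong suc (toℕ-inject₁ j))) ,
    ≤-reflexive (trans (cong (suc ∘ ∣_-_∣ (toℕ i)) (toℕ-inject₁ j)) (sym (∣m-1+n∣≡1+∣m-n∣ i≤j)))
  ... | tri> _ _ j<i =
    inj₁ (fromℕ< j+1<n) , path-adjacent _ _ (inj₂ (sym (toℕ-fromℕ< j+1<n))) ,
    ≤-reflexive (trans (cong (suc ∘ ∣_-_∣ (toℕ i)) (toℕ-fromℕ< j+1<n)) (sym (∣m-n∣≡1+∣m-1+n∣ j<i)))
    where
      j+1<n : suc (toℕ j) < n
      j+1<n = ≤-trans (s≤s j<i) (toℕ<n i)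

  splitAt≡⇒join≡ : ∀ {x s} → splitAt n x ≡ s → join n m s ≡ x
  splitAt≡⇒join≡ {x} split≡ = trans (cong (join n m) (sym split≡)) (join-splitAt n m x)

  D : Fin (n + m) → Fin (n + m) → ℕ
  D x y = dist (splitAt n x) (splitAt n y)

  D-isGraphDistance : IsGraphDistance (LP n m E) D
  D-isGraphDistance = record
    { D-refl = dist-refl ∘ splitAt n
    ; D≡0⇒≡  = λ {x} {y} D≡0 →
        trans (sym (splitAt≡⇒join≡ (dist≡0⇒≡ {splitAt n x} D≡0))) (join-splitAt n m y)
    ; D-step = λ x {y} {z} → dist-step (splitAt n x) {splitAt n y} {splitAt n z}
    ; D-pred = λ x y D>0 →
        lift {splitAt n x} {splitAt n y} (dist-pred (splitAt n x) (splitAt n y) D>0)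
    }
    where
      lift : ∀ {x y} → ∃[ r ] T (adjacent r y) × suc (dist x r) ≤ dist x y →
             ∃[ z ] T (adjacent (splitAt n z) y) × suc (dist x (splitAt n z)) ≤ dist x y
      lift {x} {y} (r , ry , r<) = join n m r ,
        subst (λ s → T (adjacent s y)) (sym (splitAt-join n m r)) ry ,
        subst (λ s → suc (dist x s) ≤ dist x y) (sym (splitAt-join n m r)) r<

  data VertexView : Fin (n + m) → Set where
    path    : ∀ i → VertexView (i ↑ˡ m)
    bristle : ∀ b → VertexView (n ↑ʳ b)

  view : ∀ x → VertexView x
  view x with splitAt n x in split≡
  ... | inj₁ i = subst VertexView (splitAt≡⇒join≡ split≡) (path i)
  ... | inj₂ b = subst VertexView (splitAt≡⇒join≡ split≡) (bristle b)

  D-join : ∀ p q → D (join n m p) (join n m q) ≡ dist p q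
  D-join p q rewrite splitAt-join n m p | splitAt-join n m q = refl

  tip : Fin (n + m)
  tip = fromℕ n′ ↑ˡ m

  ≡tip : ∀ {i} → toℕ i ≡ n′ → i ↑ˡ m ≡ tip
  ≡tip i≡n′ = cong (_↑ˡ m) (toℕ-injective (trans i≡n′ (sym (toℕ-fromℕ n′))))

  tip-bristle : ∀ b → D tip (n ↑ʳ b) ≡ n
  tip-bristle b = trans (D-join (inj₁ (fromℕ n′)) (inj₂ b)) (cong suc (toℕ-fromℕ n′))

  bristle-tip : ∀ b → D (n ↑ʳ b) tip ≡ n
  bristle-tip b = trans (D-join (inj₂ b) (inj₁ (fromℕ n′))) (cong suc (toℕ-fromℕ n′))

  path-path : ∀ i j → D (i ↑ˡ m) (j ↑ˡ m) < n
  path-path i j = subst (_< n) (sym (D-join (inj₁ i) (inj₁ j))) (∣toℕ-toℕ∣<n i j)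

  T-atDist-n : ∀ {x y} → T (atDist (LP n m E) n x y) ⇔ (D x y ≡ n)
  T-atDist-n = T-atDist D-isGraphDistance n

  sphereTerm : (Fin (n + m) → Fin (n + m)) → Fin (n + m) → Fin (n + m) → ℕ
  sphereTerm f u w = if atDist (LP n m E) n u w then label f w else 0

  sphereSum-tip : ∀ f → sphereSum (LP n m E) n f tip ≡ ∑ (label f ∘ (n ↑ʳ_))
  sphereSum-tip f = begin
    sumFin (sphereTerm f tip)                                      ≡⟨ sumFin≡∑ (sphereTerm f tip) ⟩
    ∑ (sphereTerm f tip)                                           ≡⟨ ∑-↑ˡ+↑ʳ n (sphereTerm f tip) ⟩
    ∑ (sphereTerm f tip ∘ (_↑ˡ m)) + ∑ (sphereTerm f tip ∘ (n ↑ʳ_)) ≡⟨ cong₂ _+_ (∑-zero off) (sum-cong-≗ on) ⟩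
    0 + ∑ (label f ∘ (n ↑ʳ_))                                      ∎
    where
      open ≡-Reasoning
      off : ∀ j → sphereTerm f tip (j ↑ˡ m) ≡ 0
      off j = if-¬T (λ t → <-irrefl (Equivalence.to T-atDist-n t) (path-path (fromℕ n′) j))
      on : ∀ b → sphereTerm f tip (n ↑ʳ b) ≡ label f (n ↑ʳ b)
      on b = if-T (Equivalence.from T-atDist-n (tip-bristle b))

  sphere-bristle : ∀ b {w} → (∀ c → bristleDist b c ≢ n) → D (n ↑ʳ b) w ≡ n → w ≡ tip
  sphere-bristle b {w} far D≡n with view w
  ... | path j    = ≡tip (suc-injective (trans (sym (D-join (inj₂ b) (inj₁ j))) D≡n))
  ... | bristle c = contradiction (trans (sym (D-join (inj₂ b) (inj₂ c))) D≡n) (far c)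

  sphereSum-bristle : ∀ f b → (∀ c → bristleDist b c ≢ n) →
                      sphereSum (LP n m E) n f (n ↑ʳ b) ≡ label f tip
  sphereSum-bristle f b far = begin
    sumFin (sphereTerm f (n ↑ʳ b)) ≡⟨ sumFin≡∑ (sphereTerm f (n ↑ʳ b)) ⟩
    ∑ (sphereTerm f (n ↑ʳ b))      ≡⟨ ∑-single (sphereTerm f (n ↑ʳ b)) tip off ⟩
    sphereTerm f (n ↑ʳ b) tip      ≡⟨ if-T (Equivalence.from T-atDist-n (bristle-tip b)) ⟩
    label f tip                    ∎
    where
      open ≡-Reasoning
      off : ∀ w → w ≢ tip → sphereTerm f (n ↑ʳ b) w ≡ 0
      off w w≢tip = if-¬T (w≢tip ∘ sphere-bristle b far ∘ Equivalence.to T-atDist-n)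

  sphere-nonempty : ∀ u {w} → D u w ≡ n → u ≡ tip ⊎ ∃[ b ] u ≡ n ↑ʳ b
  sphere-nonempty u {w} D≡n with view u | view w
  ... | bristle b | _         = inj₂ (b , refl)
  ... | path i    | path j    = contradiction D≡n (<⇒≢ (path-path i j))
  ... | path i    | bristle b = inj₁ (≡tip (suc-injective (trans (sym (D-join (inj₁ i) (inj₂ b))) D≡n)))

magic-lowerBound : ∀ n {m′} (E : BristleEdges (suc m′)) → 3 ≤ n →
  IsKDistMagic (LP n (suc m′) E) n → ∑ (toℕ {suc m′}) + suc m′ ≤ n + suc m′
magic-lowerBound (suc n′) {m′} E n≥3 (f , M , (f-injective , _) , _ , magic) = begin
  ∑ (toℕ {m}) + m                        ≡⟨ +-comm (∑ (toℕ {m})) m ⟩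
  m + ∑ (toℕ {m})                        ≤⟨ +-monoʳ-≤ m (∑toℕ≤∑-injective g g-injective) ⟩
  m + ∑ g                                ≡⟨ ∑-suc g ⟨
  ∑ (label f ∘ (n ↑ʳ_))                  ≡⟨ sphereSum-tip f ⟨
  sphereSum (LP n m E) n f tip           ≡⟨ magic tip (n ↑ʳ F.zero , Equivalence.from T-atDist-n (tip-bristle F.zero)) ⟩
  M                                      ≡⟨ magic (n ↑ʳ F.zero) (tip , Equivalence.from T-atDist-n (bristle-tip F.zero)) ⟨
  sphereSum (LP n m E) n f (n ↑ʳ F.zero) ≡⟨ sphereSum-bristle f F.zero far ⟩
  label f tip                            ≤⟨ toℕ<n (f tip) ⟩
  n + m                                  ∎
  where
    open LongBrush n′ (suc m′) E
    open ≤-Reasoning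
    m = suc m′
    g : Fin m → ℕ
    g = toℕ ∘ f ∘ (n ↑ʳ_)
    g-injective : ∀ {a b} → g a ≡ g b → a ≡ b
    g-injective = ↑ʳ-injective n _ _ ∘ f-injective ∘ toℕ-injective
    far : ∀ c → bristleDist F.zero c ≢ n
    far c d≡n = <⇒≱ n≥3 (subst (_≤ 2) d≡n (bristleDist≤2 F.zero c))

noBristleEdges : ∀ m → BristleEdges m
noBristleEdges m = record { vadj = λ _ _ → false ; vsym = λ _ _ → refl ; virref = λ _ → refl }

cast-↔ : ∀ {k l} → k ≡ l → Fin k ↔ Fin l
cast-↔ k≡l = mk↔ₛ′ (F.cast k≡l) (F.cast (sym k≡l))
  (cast-involutive k≡l (sym k≡l)) (cast-involutive (sym k≡l) k≡l)

bristlesFirst : ∀ n m → Fin (n + m) ↔ Fin (n + m)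
bristlesFirst n m = cast-↔ (+-comm m n) ↔-∘ (↔-sym (+↔⊎ {m}) ↔-∘ (swap-↔ ↔-∘ +↔⊎ {n}))

module _ (n m : ℕ) where
  open Inverse (bristlesFirst n m) using (to)

  toℕ-bristlesFirst-↑ʳ : ∀ b → toℕ (to (n ↑ʳ b)) ≡ toℕ b
  toℕ-bristlesFirst-↑ʳ b =
    trans (toℕ-cast (+-comm m n) _) (trans (cong (toℕ ∘ join m n ∘ swap) (splitAt-↑ʳ n m b)) (toℕ-↑ˡ b n))

  toℕ-bristlesFirst-↑ˡ : ∀ i → toℕ (to (i ↑ˡ m)) ≡ m + toℕ i
  toℕ-bristlesFirst-↑ˡ i =
    trans (toℕ-cast (+-comm m n) _) (trans (cong (toℕ ∘ join m n ∘ swap) (splitAt-↑ˡ n i m)) (toℕ-↑ʳ m i))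

magic-extremal : ∀ n′ m′ → suc n′ ≡ ∑ (toℕ {suc m′}) → suc n′ ≢ 2 →
  Σ (BristleEdges (suc m′)) λ E → IsKDistMagic (LP (suc n′) (suc m′) E) (suc n′)
magic-extremal n′ m′ n≡∑ n≢2 = E , f , n + m , f-bijective , (tip , n ↑ʳ F.zero , tip-sees) , constant
  where
    m = suc m′
    E = noBristleEdges m
    open LongBrush n′ m E
    open ≡-Reasoning
    f : Fin (n + m) → Fin (n + m)
    f = Inverse.to (bristlesFirst n m)
    f-bijective : Bijective _≡_ _≡_ f
    f-bijective = Bijection.bijective (↔⇒⤖ (bristlesFirst n m))
    far : ∀ b c → bristleDist b c ≢ n
    far b c d≡n with bristleDist-pos b c (subst (0 <_) (sym d≡n) (s≤s z≤n))
    ... | inj₁ (() , _)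
    ... | inj₂ d≡2 = n≢2 (trans (sym d≡n) d≡2)
    tip-sees : T (atDist (LP n m E) n tip (n ↑ʳ F.zero))
    tip-sees = Equivalence.from T-atDist-n (tip-bristle F.zero)
    constant : ∀ u → ∃[ w ] T (atDist (LP n m E) n u w) → sphereSum (LP n m E) n f u ≡ n + m
    constant u (w , t) with sphere-nonempty u {w} (Equivalence.to (T-atDist-n {u} {w}) t)
    ... | inj₁ refl = begin
      sphereSum (LP n m E) n f tip ≡⟨ sphereSum-tip f ⟩
      ∑ (label f ∘ (n ↑ʳ_))        ≡⟨ sum-cong-≗ {m} (cong suc ∘ toℕ-bristlesFirst-↑ʳ n m) ⟩
      ∑ (suc ∘ toℕ {m})            ≡⟨ ∑-suc {m} toℕ ⟩
      m + ∑ (toℕ {m})              ≡⟨ cong (m +_) n≡∑ ⟨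
      m + n                        ≡⟨ +-comm m n ⟩
      n + m                        ∎
    ... | inj₂ (b , refl) = begin
      sphereSum (LP n m E) n f (n ↑ʳ b) ≡⟨ sphereSum-bristle f b (far b) ⟩
      label f tip                       ≡⟨ cong suc (toℕ-bristlesFirst-↑ˡ n m (fromℕ n′)) ⟩
      suc (m + toℕ (fromℕ n′))          ≡⟨ cong (suc ∘ (m +_)) (toℕ-fromℕ n′) ⟩
      suc (m + n′)                      ≡⟨ +-suc m n′ ⟨
      m + n                             ≡⟨ +-comm m n ⟩
      n + m                             ∎

corollary3p5 : (m : ℕ) → 2 ≤ m →
    Σ (BristleEdges m) (λ E → IsKDistMagic (LP (tri m) m E) (tri m))
    × ((n : ℕ) → (E : BristleEdges m) → 3 ≤ n →
        IsKDistMagic (LP n m E) n → tri m + m ≤ n + m)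
corollary3p5 1 (s≤s ())
corollary3p5 m@(suc (suc k)) _ = extremal , lowerBound
  where
    tri≡∑ : tri m ≡ ∑ (toℕ {m})
    tri≡∑ = tri≡∑toℕ m
    extremal : Σ (BristleEdges m) (λ E → IsKDistMagic (LP (tri m) m E) (tri m))
    extremal = subst (λ n → Σ (BristleEdges m) (λ E → IsKDistMagic (LP n m E) n)) (sym tri≡∑)
      (magic-extremal _ (suc k) refl (∑toℕ≢2 m))
    lowerBound : ∀ n E → 3 ≤ n → IsKDistMagic (LP n m E) n → tri m + m ≤ n + m
    lowerBound n E n≥3 magic = subst (λ t → t + m ≤ n + m) (sym tri≡∑) (magic-lowerBound n E n≥3 magic)
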